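{- Let $\Gamma=(X,\ast,t)$ be a pregeometry with type set $I$ all of whose rank 2 truncations are connected, let $G\leq\operatorname{Aut}\Gamma$ be transitive on each $X_i$, and suppose $\Gamma$ is fully $G$-primitive. Then there exists a unique partition $\{I_1,\dots,I_\ell\}$ of $I$ such that for each $i$ the truncation $\Gamma_{I_i}$ is an indecomposable, fully $G$-faithful, fully $G$-primitive pregeometry, and $\Gamma=\Gamma_{I_1}\oplus\cdots\oplus\Gamma_{I_\ell}$.
   Context: A pregeometry $\Gamma=(X,\ast,t)$: finite set $X$, symmetric reflexive incidence $\ast$, surjection $t:X\to I$ onto types, distinct incident elements having distinct types; $X_i=t^{ -1}(i)$. The $J$-truncation $\Gamma_J$ has elements $t^{ -1}(J)$ with restricted incidence and types. Rank 2 truncations connected: for distinct $i,j$ the graph on $X_i\cup X_j$ with edges between incident elements of distinct types is connected. Automorphisms preserve types and incidence. For $J\subseteq I$, $\Gamma_J$ is fully $G$-faithful (resp. fully $G$-primitive) if the group induced by $G$ on the elements of $\Gamma_J$ is faithful (resp. primitive) on $X_j$ for every $j\in J$. $\Gamma=\Gamma_{I_1}\oplus\cdots\oplus\Gamma_{I_\ell}$ means every element with type in $I_a$ is incident with every element with type in $I_b$ for $a\neq b$. A pregeometry is indecomposable if its type set admits no partition into two nonempty parts with this complete-incidence property. -}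

module Defs where

open import Data.Nat using (ℕ)
open import Data.Fin using (Fin)
open import Data.Fin.Permutation using (Permutation′; _⟨$⟩ʳ_; id; flip; _∘ₚ_)
open import Data.Bool using (Bool; true; false)
open import Data.Product using (Σ; ∃; ∃-syntax; _×_; _,_)
open import Data.Sum using (_⊎_)
open import Relation.Binary.PropositionalEquality using (_≡_; _≢_)
open import Relation.Binary.Construct.Closure.ReflexiveTransitive using (Star)
open import Relation.Nullary using (¬_)
open import Level using (0ℓ)
open import Relation.Unary using (Pred; _∈_)
open import Function.Bundles using (_⇔_)

-- Pregeometries.  Elements X = Fin nX, type set I = Fin nI.
-- The incidence relation on the finite set X is given by its (Bool-valued)
-- characteristic function.

record Pregeometry : Set where
  field
    nX    : ℕ
    nI    : ℕ
    inc   : Fin nX → Fin nX → Bool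
    t     : Fin nX → Fin nI
    inc-refl : ∀ x → inc x x ≡ true
    inc-sym  : ∀ x y → inc x y ≡ inc y x
    t-surj   : ∀ (i : Fin nI) → ∃[ x ] t x ≡ i
    inc-types : ∀ x y → inc x y ≡ true → t x ≡ t y → x ≡ y

module _ (Γ : Pregeometry) where
  open Pregeometry Γ

  TypeSet : Set₁
  TypeSet = Pred (Fin nI) 0ℓ

  Adj₂ : Fin nI → Fin nI → Fin nX → Fin nX → Set
  Adj₂ i j x y = (t x ≡ i ⊎ t x ≡ j) × (t y ≡ i ⊎ t y ≡ j)
               × t x ≢ t y × inc x y ≡ true

  Rank2Connected : Set
  Rank2Connected = ∀ (i j : Fin nI) → i ≢ j →
    ∀ x y → (t x ≡ i ⊎ t x ≡ j) → (t y ≡ i ⊎ t y ≡ j) → Star (Adj₂ i j) x y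

  IsAut : Permutation′ nX → Set
  IsAut g = (∀ x → t (g ⟨$⟩ʳ x) ≡ t x)
          × (∀ x y → inc (g ⟨$⟩ʳ x) (g ⟨$⟩ʳ y) ≡ inc x y)

  record IsAutSubgroup (G : Pred (Permutation′ nX) 0ℓ) : Set where
    field
      G-id   : id ∈ G
      G-comp : ∀ {g h} → g ∈ G → h ∈ G → (g ∘ₚ h) ∈ G
      G-inv  : ∀ {g} → g ∈ G → flip g ∈ G
      G-aut  : ∀ {g} → g ∈ G → IsAut g

  module _ (G : Pred (Permutation′ nX) 0ℓ) where

    TransitiveOn : Fin nI → Set
    TransitiveOn i = ∀ x y → t x ≡ i → t y ≡ i →
      ∃[ g ] (g ∈ G × g ⟨$⟩ʳ x ≡ y)

    IsBlock : Fin nI → (Fin nX → Bool) → Set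
    IsBlock i B = (∀ x → B x ≡ true → t x ≡ i)
      × (∀ g → g ∈ G →
           (∀ x → B x ≡ true → B (g ⟨$⟩ʳ x) ≡ true)
         ⊎ (∀ x → B x ≡ true → B (g ⟨$⟩ʳ x) ≡ false))

    TrivialBlock : Fin nI → (Fin nX → Bool) → Set
    TrivialBlock i B = (∀ x y → B x ≡ true → B y ≡ true → x ≡ y)
                     ⊎ (∀ x → t x ≡ i → B x ≡ true)

    -- G (equivalently, the group induced by G on any truncation containing
    -- type i) is primitive on X_i: transitive with only trivial blocks.
    PrimitiveOn : Fin nI → Set
    PrimitiveOn i = TransitiveOn i × (∀ B → IsBlock i B → TrivialBlock i B)

    -- The group induced by G on the elements of Γ_J is faithful on X_j:
    -- an element of G fixing X_j pointwise fixes every element of Γ_J.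
    FaithfulOn : TypeSet → Fin nI → Set
    FaithfulOn J j = ∀ g → g ∈ G → (∀ x → t x ≡ j → g ⟨$⟩ʳ x ≡ x) →
      ∀ x → t x ∈ J → g ⟨$⟩ʳ x ≡ x

    FullyFaithful : TypeSet → Set
    FullyFaithful J = ∀ j → j ∈ J → FaithfulOn J j

    FullyPrimitive : TypeSet → Set
    FullyPrimitive J = ∀ j → j ∈ J → PrimitiveOn j

  Decomposes : TypeSet → (Fin nI → Bool) → Set
  Decomposes J K = (∃[ i ] (i ∈ J × K i ≡ true))
                 × (∃[ i ] (i ∈ J × K i ≡ false))
                 × (∀ x y → t x ∈ J → K (t x) ≡ true
                          → t y ∈ J → K (t y) ≡ false → inc x y ≡ true)

  Indecomposable : TypeSet → Set
  Indecomposable J = ∀ K → ¬ Decomposes J K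

  -- Partitions {I_1,…,I_ℓ} of I, given by a surjective labelling
  -- c : I → Fin ℓ (block I_a = c⁻¹(a); surjectivity = blocks nonempty).

  record Partition : Set where
    field
      ℓ      : ℕ
      label  : Fin nI → Fin ℓ
      label-surj : ∀ (a : Fin ℓ) → ∃[ i ] label i ≡ a

  Block : (P : Partition) → Fin (Partition.ℓ P) → TypeSet
  Block P a i = Partition.label P i ≡ a

  -- Two partitions are equal (as sets of blocks)
  SamePartition : Partition → Partition → Set
  SamePartition P Q = ∀ i j →
    (Partition.label P i ≡ Partition.label P j) ⇔ (Partition.label Q i ≡ Partition.label Q j)

  IsDirectSum : Partition → Set
  IsDirectSum P = ∀ x y →
    Partition.label P (t x) ≢ Partition.label P (t y) → inc x y ≡ true

  GoodPartition : Pred (Permutation′ nX) 0ℓ → Partition → Set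
  GoodPartition G P =
      (∀ a → Indecomposable (Block P a)
           × FullyFaithful G (Block P a)
           × FullyPrimitive G (Block P a))
    × IsDirectSum P

-- Call types a and b linked if some element of type a is not incident with
-- some element of type b.  The partition is the one into connected components
-- of this graph on I: elements in different components are always incident,
-- which is the direct sum decomposition; a component cannot be split into two
-- mutually incident parts because some link crosses the split; and for the
-- same two reasons every direct sum decomposition into indecomposable summands
-- has the same parts.  For faithfulness, let g ∈ G fix X_i pointwise and let
-- i, j be linked.  For y ∈ X_j the elements of X_j with the same neighbours in
-- X_i as y form a block of G on X_j that contains g y.  The block is not all
-- of X_j, for then an element of X_i with a non-neighbour in X_j would have no
-- neighbour in X_j, against connectivity of Γ_{i,j}; by primitivity it is
-- {y}, so g y = y.  Fixing a type pointwise thus spreads along links.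
module Submission where

open import Defs
open import Data.Fin.Permutation using (Permutation′; _⟨$⟩ʳ_; _⟨$⟩ˡ_; inverseʳ)
open import Data.Product using (Σ; _×_; _,_; proj₁; proj₂; ∃; ∃₂)
open import Relation.Unary using (Pred; U; _∈_)
open import Level using (0ℓ)
open import Data.Nat using (ℕ; zero; suc)
open import Data.Fin using (Fin; zero; suc; _≟_)
open import Data.Fin.Properties using (any?; all?; suc-injective)
open import Data.Bool using (Bool; true; false; if_then_else_)
import Data.Bool.Properties as Bool
open import Data.Sum using (_⊎_; inj₁; inj₂)
open import Data.Empty using (⊥-elim)
open import Data.Unit using (tt)
open import Data.List using (List; []; _∷_; foldr; allFin; cartesianProduct)
open import Data.List.Membership.Propositional using () renaming (_∈_ to _∈ₗ_)
open import Data.List.Membership.Propositional.Properties using (∈-allFin; ∈-cartesianProduct⁺)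
open import Data.List.Relation.Unary.Any using (here; there)
open import Function using (id; _∘_)
open import Function.Bundles using (mk⇔)
open import Relation.Binary using (Rel; Symmetric)
open import Relation.Binary.Definitions using (DecidableEquality)
open import Relation.Binary.PropositionalEquality using (_≡_; _≢_; refl; sym; trans; cong; module ≡-Reasoning)
open import Relation.Binary.Construct.Closure.ReflexiveTransitive using (Star; ε; _◅_; _◅◅_; fold)
open import Relation.Nullary using (Dec; yes; no; does)
open import Relation.Nullary.Decidable using (_×-dec_; _→-dec_; dec-true; dec-false)

witness : {A : Set} (d : Dec A) → does d ≡ true → A
witness (yes a) _ = a

true≢false : true ≢ false
true≢false ()

firstExit : {A : Set} {R : Rel A 0ℓ} (K : A → Bool) {a b : A} → Star R a b →
  K a ≡ true → K b ≡ false →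
  ∃₂ λ c d → Star R a c × R c d × K c ≡ true × K d ≡ false
firstExit K ε Ka Kb = ⊥-elim (true≢false (trans (sym Ka) Kb))
firstExit K (_◅_ {j = d} e rest) Ka Kb with K d in Kd
... | true  = let c , c′ , d⇝c , exit = firstExit K rest Kd Kb in c , c′ , e ◅ d⇝c , exit
... | false = _ , d , ε , e , Ka , Kd

record ImageIndexing {n : ℕ} {A : Set} (f : Fin n → A) : Set where
  field
    size             : ℕ
    index            : Fin n → Fin size
    index-surjective : ∀ k → ∃ λ i → index i ≡ k
    index-≡⇒         : ∀ i j → index i ≡ index j → f i ≡ f j
    ≡⇒index-≡        : ∀ i j → f i ≡ f j → index i ≡ index j

module _ {n : ℕ} {A : Set} {f : Fin (suc n) → A} (I : ImageIndexing (f ∘ suc)) where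
  open ImageIndexing I

  reuseIndexing : (k : Fin n) → f (suc k) ≡ f zero → ImageIndexing f
  reuseIndexing k fk≡f0 = record
    { size = size ; index = index′ ; index-surjective = surjective
    ; index-≡⇒ = sound ; ≡⇒index-≡ = complete }
    where
      index′ : Fin (suc n) → Fin size
      index′ zero    = index k
      index′ (suc i) = index i
      surjective : ∀ a → ∃ λ i → index′ i ≡ a
      surjective a = let i , eq = index-surjective a in suc i , eq
      sound : ∀ i j → index′ i ≡ index′ j → f i ≡ f j
      sound zero    zero    _  = refl
      sound zero    (suc j) eq = trans (sym fk≡f0) (index-≡⇒ k j eq)
      sound (suc i) zero    eq = trans (index-≡⇒ i k eq) fk≡f0
      sound (suc i) (suc j) eq = index-≡⇒ i j eq
      complete : ∀ i j → f i ≡ f j → index′ i ≡ index′ j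
      complete zero    zero    _  = refl
      complete zero    (suc j) eq = ≡⇒index-≡ k j (trans fk≡f0 eq)
      complete (suc i) zero    eq = ≡⇒index-≡ i k (trans eq (sym fk≡f0))
      complete (suc i) (suc j) eq = ≡⇒index-≡ i j eq

  freshIndexing : (∀ k → f (suc k) ≢ f zero) → ImageIndexing f
  freshIndexing f0-new = record
    { size = suc size ; index = index′ ; index-surjective = surjective
    ; index-≡⇒ = sound ; ≡⇒index-≡ = complete }
    where
      index′ : Fin (suc n) → Fin (suc size)
      index′ zero    = zero
      index′ (suc i) = suc (index i)
      surjective : ∀ a → ∃ λ i → index′ i ≡ a
      surjective zero    = zero , refl
      surjective (suc a) = let i , eq = index-surjective a in suc i , cong suc eq
      sound : ∀ i j → index′ i ≡ index′ j → f i ≡ f j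
      sound zero    zero    _  = refl
      sound (suc i) (suc j) eq = index-≡⇒ i j (suc-injective eq)
      complete : ∀ i j → f i ≡ f j → index′ i ≡ index′ j
      complete zero    zero    _  = refl
      complete zero    (suc j) eq = ⊥-elim (f0-new j (sym eq))
      complete (suc i) zero    eq = ⊥-elim (f0-new i eq)
      complete (suc i) (suc j) eq = cong suc (≡⇒index-≡ i j eq)

imageIndexing : {A : Set} → DecidableEquality A → {n : ℕ} (f : Fin n → A) → ImageIndexing f
imageIndexing _≟ᴬ_ {zero} f = record
  { size = 0 ; index = λ () ; index-surjective = λ ()
  ; index-≡⇒ = λ () ; ≡⇒index-≡ = λ () }
imageIndexing _≟ᴬ_ {suc n} f with any? (λ k → f (suc k) ≟ᴬ f zero)
... | yes (k , fk≡f0) = reuseIndexing (imageIndexing _≟ᴬ_ (f ∘ suc)) k fk≡f0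
... | no f0-new       = freshIndexing (imageIndexing _≟ᴬ_ (f ∘ suc)) (λ k eq → f0-new (k , eq))

-- Connected components, by merging labels along every edge

module Components {n : ℕ} (R : Rel (Fin n) 0ℓ) (R? : ∀ a b → Dec (R a b))
                  (R-sym : Symmetric R) where

  Sound : (Fin n → Fin n) → Set
  Sound f = ∀ x y → f x ≡ f y → Star R x y

  rename : Fin n → Fin n → Fin n → Fin n
  rename old new v = if does (v ≟ old) then new else v

  rename-cases : ∀ old new v → (v ≡ old × rename old new v ≡ new) ⊎ (v ≢ old × rename old new v ≡ v)
  rename-cases old new v with v ≟ old
  ... | yes v≡old = inj₁ (v≡old , refl)
  ... | no  v≢old = inj₂ (v≢old , refl)

  merge : (Fin n → Fin n) → Fin n → Fin n → Fin n → Fin n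
  merge f a b = rename (f b) (f a) ∘ f

  merge-identifies : ∀ f a b → merge f a b a ≡ merge f a b b
  merge-identifies f a b with rename-cases (f b) (f a) (f a) | rename-cases (f b) (f a) (f b)
  ... | inj₁ (_ , ra) | inj₁ (_ , rb) = trans ra (sym rb)
  ... | inj₂ (_ , ra) | inj₁ (_ , rb) = trans ra (sym rb)
  ... | _             | inj₂ (fb≢fb , _) = ⊥-elim (fb≢fb refl)

  merge-sound : ∀ f a b → R a b → Sound f → Sound (merge f a b)
  merge-sound f a b e sound x y eq with rename-cases (f b) (f a) (f x) | rename-cases (f b) (f a) (f y)
  ... | inj₁ (fx≡fb , _)  | inj₁ (fy≡fb , _)  = sound x y (trans fx≡fb (sym fy≡fb))
  ... | inj₁ (fx≡fb , rx) | inj₂ (_ , ry)     =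
    sound x b fx≡fb ◅◅ R-sym e ◅ sound a y (trans (sym rx) (trans eq ry))
  ... | inj₂ (_ , rx)     | inj₁ (fy≡fb , ry) =
    sound x a (trans (sym rx) (trans eq ry)) ◅◅ e ◅ sound b y (sym fy≡fb)
  ... | inj₂ (_ , rx)     | inj₂ (_ , ry)     = sound x y (trans (sym rx) (trans eq ry))

  step : Fin n × Fin n → (Fin n → Fin n) → Fin n → Fin n
  step (a , b) f with R? a b
  ... | yes _ = merge f a b
  ... | no  _ = f

  step-sound : ∀ p f → Sound f → Sound (step p f)
  step-sound (a , b) f sound with R? a b
  ... | yes e = merge-sound f a b e sound
  ... | no  _ = sound

  step-keeps : ∀ p f x y → f x ≡ f y → step p f x ≡ step p f y
  step-keeps (a , b) f x y eq with R? a b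
  ... | yes _ = cong (rename (f b) (f a)) eq
  ... | no  _ = eq

  step-identifies : ∀ a b f → R a b → step (a , b) f a ≡ step (a , b) f b
  step-identifies a b f e with R? a b
  ... | yes _ = merge-identifies f a b
  ... | no ¬e = ⊥-elim (¬e e)

  mergeAll : List (Fin n × Fin n) → Fin n → Fin n
  mergeAll = foldr step id

  mergeAll-sound : ∀ ps → Sound (mergeAll ps)
  mergeAll-sound []       x .x refl = ε
  mergeAll-sound (p ∷ ps) = step-sound p (mergeAll ps) (mergeAll-sound ps)

  mergeAll-identifies : ∀ {a b} ps → (a , b) ∈ₗ ps → R a b → mergeAll ps a ≡ mergeAll ps b
  mergeAll-identifies {a} {b} (_ ∷ ps) (here refl) e = step-identifies a b (mergeAll ps) e
  mergeAll-identifies {a} {b} (p ∷ ps) (there ab∈ps) e =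
    step-keeps p (mergeAll ps) a b (mergeAll-identifies ps ab∈ps e)

  allPairs : List (Fin n × Fin n)
  allPairs = cartesianProduct (allFin n) (allFin n)

  component : Fin n → Fin n
  component = mergeAll allPairs

  component-≡⇒Star : ∀ a b → component a ≡ component b → Star R a b
  component-≡⇒Star = mergeAll-sound allPairs

  Star⇒component-≡ : ∀ {a b} → Star R a b → component a ≡ component b
  Star⇒component-≡ = fold (λ a b → component a ≡ component b) (λ e eq → trans (edge e) eq) refl
    where
      edge : ∀ {a b} → R a b → component a ≡ component b
      edge {a} {b} = mergeAll-identifies allPairs (∈-cartesianProduct⁺ (∈-allFin a) (∈-allFin b))

module _ (Γ : Pregeometry) where
  open Pregeometry Γ

  Linked : Rel (Fin nI) 0ℓ
  Linked a b = ∃₂ λ x y → t x ≡ a × t y ≡ b × inc x y ≡ false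

  linked? : ∀ a b → Dec (Linked a b)
  linked? a b = any? λ x → any? λ y → t x ≟ a ×-dec t y ≟ b ×-dec inc x y Bool.≟ false

  linked-sym : Symmetric Linked
  linked-sym (x , y , tx , ty , x∤y) = y , x , ty , tx , trans (inc-sym y x) x∤y

  incidentOfType : Rank2Connected Γ → ∀ {i j} → i ≢ j → ∀ {x} → t x ≡ i →
    ∃ λ z → t z ≡ j × inc x z ≡ true
  incidentOfType conn {i} {j} i≢j {x} tx≡i =
    let y , ty≡j = t-surj j in firstStep ty≡j (conn i j i≢j x y (inj₁ tx≡i) (inj₂ ty≡j))
    where
      firstStep : ∀ {y} → t y ≡ j → Star (Adj₂ Γ i j) x y → ∃ λ z → t z ≡ j × inc x z ≡ true
      firstStep ty≡j ε = ⊥-elim (i≢j (trans (sym tx≡i) ty≡j))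
      firstStep _ ((_ , inj₁ tw≡i , tx≢tw , _) ◅ _) = ⊥-elim (tx≢tw (trans tx≡i (sym tw≡i)))
      firstStep _ ((_ , inj₂ tw≡j , _ , x∗w) ◅ _) = _ , tw≡j , x∗w

  open Components Linked linked? linked-sym
  open ImageIndexing (imageIndexing _≟_ component)

  linkComponents : Partition Γ
  linkComponents = record { ℓ = size ; label = index ; label-surj = index-surjective }

  sameComponent⇒Star : ∀ {a b} → index a ≡ index b → Star Linked a b
  sameComponent⇒Star {a} {b} eq = component-≡⇒Star a b (index-≡⇒ a b eq)

  Star⇒sameComponent : ∀ {a b} → Star Linked a b → index a ≡ index b
  Star⇒sameComponent {a} {b} path = ≡⇒index-≡ a b (Star⇒component-≡ path)

  linkComponents-directSum : IsDirectSum Γ linkComponents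
  linkComponents-directSum x y different with inc x y in x∗y
  ... | true  = refl
  ... | false = ⊥-elim (different (Star⇒sameComponent ((x , y , refl , refl , x∗y) ◅ ε)))

  linkComponents-indecomposable : ∀ a → Indecomposable Γ (Block Γ linkComponents a)
  linkComponents-indecomposable a K ((i , i∈a , Ki) , (j , j∈a , Kj) , complete)
    with firstExit K (sameComponent⇒Star (trans i∈a (sym j∈a))) Ki Kj
  ... | c , d , i⇝c , link@(x , y , refl , refl , x∤y) , Kc , Kd =
    true≢false (trans (sym (complete x y c∈a Kc d∈a Kd)) x∤y)
    where
      c∈a : index (t x) ≡ a
      c∈a = trans (sym (Star⇒sameComponent i⇝c)) i∈a
      d∈a : index (t y) ≡ a
      d∈a = trans (sym (Star⇒sameComponent (link ◅ ε))) c∈a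

  module _ (P : Partition Γ) (sum : IsDirectSum Γ P) where
    open Partition P

    directSum-respects-links : ∀ {a b} → Star Linked a b → label a ≡ label b
    directSum-respects-links = fold (λ a b → label a ≡ label b) (λ e eq → trans (edge e) eq) refl
      where
        edge : ∀ {a b} → Linked a b → label a ≡ label b
        edge (x , y , refl , refl , x∤y) with label (t x) ≟ label (t y)
        ... | yes same = same
        ... | no different = ⊥-elim (true≢false (trans (sym (sum x y different)) x∤y))

    indecomposable⊆summand : ∀ {J} → Indecomposable Γ J → ∀ {i j} → i ∈ J → j ∈ J → label i ≡ label j
    indecomposable⊆summand {J} indecomposable {i} {j} i∈J j∈J with label i ≟ label j
    ... | yes same = same
    ... | no different = ⊥-elim (indecomposable K (i∈K , j∉K , complete))
      where
        K : Fin nI → Bool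
        K c = does (label c ≟ label i)
        i∈K : ∃ λ c → c ∈ J × K c ≡ true
        i∈K = i , i∈J , dec-true (label i ≟ label i) refl
        j∉K : ∃ λ c → c ∈ J × K c ≡ false
        j∉K = j , j∈J , dec-false (label j ≟ label i) (different ∘ sym)
        complete : ∀ x y → t x ∈ J → K (t x) ≡ true → t y ∈ J → K (t y) ≡ false → inc x y ≡ true
        complete x y _ Kx _ Ky = sum x y λ same →
          true≢false (trans (sym (dec-true (label (t y) ≟ label i) (trans (sym same) x∈i))) Ky)
          where
            x∈i : label (t x) ≡ label i
            x∈i = witness (label (t x) ≟ label i) Kx

  FixesType : Fin nI → Permutation′ nX → Set
  FixesType i g = ∀ x → t x ≡ i → g ⟨$⟩ʳ x ≡ x

  SameTrace : Fin nI → Fin nX → Fin nX → Set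
  SameTrace i z w = ∀ x → t x ≡ i → inc x z ≡ inc x w

  aut-preserves-trace : ∀ {g} → IsAut Γ g → ∀ {i z w} → SameTrace i z w →
    SameTrace i (g ⟨$⟩ʳ z) (g ⟨$⟩ʳ w)
  aut-preserves-trace {g} (type-pres , inc-pres) {i} {z} {w} same x tx≡i = begin
    inc x (g ⟨$⟩ʳ z)              ≡⟨ cong (λ u → inc u (g ⟨$⟩ʳ z)) (sym g⁻¹x↦x) ⟩
    inc (g ⟨$⟩ʳ x′) (g ⟨$⟩ʳ z)    ≡⟨ inc-pres x′ z ⟩
    inc x′ z                      ≡⟨ same x′ tx′≡i ⟩
    inc x′ w                      ≡⟨ sym (inc-pres x′ w) ⟩
    inc (g ⟨$⟩ʳ x′) (g ⟨$⟩ʳ w)    ≡⟨ cong (λ u → inc u (g ⟨$⟩ʳ w)) g⁻¹x↦x ⟩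
    inc x (g ⟨$⟩ʳ w)              ∎
    where
      open ≡-Reasoning
      x′ : Fin nX
      x′ = g ⟨$⟩ˡ x
      g⁻¹x↦x : g ⟨$⟩ʳ x′ ≡ x
      g⁻¹x↦x = inverseʳ g
      tx′≡i : t x′ ≡ i
      tx′≡i = trans (sym (type-pres x′)) (trans (cong t g⁻¹x↦x) tx≡i)

  InTraceClass : Fin nI → Fin nI → Fin nX → Fin nX → Set
  InTraceClass i j y z = t z ≡ j × SameTrace i z y

  inTraceClass? : ∀ i j y z → Dec (InTraceClass i j y z)
  inTraceClass? i j y z = t z ≟ j ×-dec all? λ x → t x ≟ i →-dec inc x z Bool.≟ inc x y

  traceClass : Fin nI → Fin nI → Fin nX → Fin nX → Bool
  traceClass i j y z = does (inTraceClass? i j y z)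

  module _ {G : Pred (Permutation′ nX) 0ℓ} (G-aut : ∀ {g} → g ∈ G → IsAut Γ g) where

    traceClass-isBlock : ∀ i {j y} → t y ≡ j → IsBlock Γ G j (traceClass i j y)
    traceClass-isBlock i {j} {y} ty≡j = (λ z z∈B → proj₁ (witness (inTraceClass? i j y z) z∈B)) , stable
      where
        stable : ∀ g → g ∈ G → (∀ z → traceClass i j y z ≡ true → traceClass i j y (g ⟨$⟩ʳ z) ≡ true)
                              ⊎ (∀ z → traceClass i j y z ≡ true → traceClass i j y (g ⟨$⟩ʳ z) ≡ false)
        stable g g∈G with inTraceClass? i j y (g ⟨$⟩ʳ y)
        ... | yes (_ , gy~y) = inj₁ λ z z∈B →
          let tz≡j , z~y = witness (inTraceClass? i j y z) z∈B
          in dec-true (inTraceClass? i j y (g ⟨$⟩ʳ z))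
               ( trans (proj₁ (G-aut g∈G) z) tz≡j
               , λ x tx → trans (aut-preserves-trace {g} (G-aut g∈G) {i} z~y x tx) (gy~y x tx))
        ... | no gy∉B = inj₂ λ z z∈B →
          let _ , z~y = witness (inTraceClass? i j y z) z∈B
          in dec-false (inTraceClass? i j y (g ⟨$⟩ʳ z)) λ (_ , gz~y) → gy∉B
               ( trans (proj₁ (G-aut g∈G) y) ty≡j
               , λ x tx → trans (sym (aut-preserves-trace {g} (G-aut g∈G) {i} z~y x tx)) (gz~y x tx))

    fixesType-spreads : Rank2Connected Γ → ∀ {i j} → PrimitiveOn Γ G j → Linked i j →
      ∀ {g} → g ∈ G → FixesType i g → FixesType j g
    fixesType-spreads conn {i} {j} (_ , onlyTrivialBlocks) (x₀ , y₀ , tx₀≡i , ty₀≡j , x₀∤y₀) {g} g∈G fixes y ty≡j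
      with i ≟ j
    ... | yes refl = fixes y ty≡j
    ... | no i≢j with onlyTrivialBlocks (traceClass i j y) (traceClass-isBlock i ty≡j)
    ...   | inj₁ atMostOnePoint = atMostOnePoint _ _ gy∈B y∈B
      where
        y∈B : traceClass i j y y ≡ true
        y∈B = dec-true (inTraceClass? i j y y) (ty≡j , λ _ _ → refl)
        gy∈B : traceClass i j y (g ⟨$⟩ʳ y) ≡ true
        gy∈B = dec-true (inTraceClass? i j y (g ⟨$⟩ʳ y))
          ( trans (proj₁ (G-aut g∈G) y) ty≡j
          , λ x tx → trans (cong (λ u → inc u (g ⟨$⟩ʳ y)) (sym (fixes x tx))) (proj₂ (G-aut g∈G) x y))
    ...   | inj₂ wholeType = ⊥-elim (true≢false (begin
      true          ≡⟨ sym x₀∗z ⟩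
      inc x₀ z      ≡⟨ proj₂ (witness (inTraceClass? i j y z) (wholeType z tz≡j)) x₀ tx₀≡i ⟩
      inc x₀ y      ≡⟨ sym (proj₂ (witness (inTraceClass? i j y y₀) (wholeType y₀ ty₀≡j)) x₀ tx₀≡i) ⟩
      inc x₀ y₀     ≡⟨ x₀∤y₀ ⟩
      false         ∎))
      where
        open ≡-Reasoning
        neighbour : ∃ λ z → t z ≡ j × inc x₀ z ≡ true
        neighbour = incidentOfType conn i≢j tx₀≡i
        z : Fin nX
        z = proj₁ neighbour
        tz≡j : t z ≡ j
        tz≡j = proj₁ (proj₂ neighbour)
        x₀∗z : inc x₀ z ≡ true
        x₀∗z = proj₂ (proj₂ neighbour)

    fixesType-propagates : Rank2Connected Γ → FullyPrimitive Γ G U →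
      ∀ {i j} → Star Linked i j → ∀ {g} → g ∈ G → FixesType i g → FixesType j g
    fixesType-propagates conn fullyPrimitive path {g} g∈G =
      fold (λ i j → FixesType i g → FixesType j g)
           (λ link spread fixes → spread (fixesType-spreads conn (fullyPrimitive _ tt) link g∈G fixes))
           id path

    linkComponents-fullyFaithful : Rank2Connected Γ → FullyPrimitive Γ G U →
      ∀ a → FullyFaithful Γ G (Block Γ linkComponents a)
    linkComponents-fullyFaithful conn fullyPrimitive a j j∈a g g∈G fixes x tx∈a =
      fixesType-propagates conn fullyPrimitive (sameComponent⇒Star (trans j∈a (sym tx∈a))) g∈G fixes x refl

corollary3p3 : (Γ : Pregeometry) → Rank2Connected Γ →
    (G : Pred (Permutation′ (Pregeometry.nX Γ)) 0ℓ) → IsAutSubgroup Γ G →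
    (∀ i → TransitiveOn Γ G i) → FullyPrimitive Γ G U →
    Σ (Partition Γ) (λ P → GoodPartition Γ G P
    × (∀ Q → GoodPartition Γ G Q → SamePartition Γ P Q))
corollary3p3 Γ conn G isAutSubgroup _ fullyPrimitive = linkComponents Γ , good , unique
  where
    G-aut : ∀ {g} → g ∈ G → IsAut Γ g
    G-aut = IsAutSubgroup.G-aut isAutSubgroup

    good : GoodPartition Γ G (linkComponents Γ)
    good = (λ a → linkComponents-indecomposable Γ a
                , linkComponents-fullyFaithful Γ G-aut conn fullyPrimitive a
                , λ j _ → fullyPrimitive j tt)
         , linkComponents-directSum Γ

    unique : ∀ Q → GoodPartition Γ G Q → SamePartition Γ (linkComponents Γ) Q
    unique Q (summands , directSum) i j = mk⇔
      (λ sameP → directSum-respects-links Γ Q directSum (sameComponent⇒Star Γ sameP))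
      (λ sameQ → indecomposable⊆summand Γ (linkComponents Γ) (linkComponents-directSum Γ)
                   (proj₁ (summands (label i))) refl (sym sameQ))
      where open Partition Q
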